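{- In any bisemigroup, each element has at most one left complement and at most one right complement.
   Context: A bisemigroup $\langle A,\leq,\cdot,+\rangle$ is a partially ordered set with two associative operations, both order preserving in each argument with respect to $\leq$, satisfying the hemidistributive laws $x\cdot(y+z)\leq (x\cdot y)+z$ and $(z+y)\cdot x\leq z+(y\cdot x)$. An element $y$ is a left complement of $x$ if for all $w$: $w+(y\cdot x)\leq w$, $(y\cdot x)+w\leq w$, $w\leq w\cdot(x+y)$, $w\leq (x+y)\cdot w$. It is a right complement of $x$ if for all $w$: $w+(x\cdot y)\leq w$, $(x\cdot y)+w\leq w$, $w\leq w\cdot(y+x)$, $w\leq (y+x)\cdot w$. -}

module Defs where

open import Level using (Level; suc; _⊔_)
open import Relation.Binary.PropositionalEquality using (_≡_)
open import Relation.Binary.Structures using (IsPartialOrder)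

record Bisemigroup (c ℓ : Level) : Set (suc (c ⊔ ℓ)) where
  infixl 7 _·_
  infixl 6 _+_
  infix 4 _≤_
  field
    Carrier        : Set c
    _≤_            : Carrier → Carrier → Set (c ⊔ ℓ)
    _·_            : Carrier → Carrier → Carrier
    _+_            : Carrier → Carrier → Carrier
    isPartialOrder : IsPartialOrder _≡_ _≤_
    ·-assoc        : ∀ x y z → (x · y) · z ≡ x · (y · z)
    +-assoc        : ∀ x y z → (x + y) + z ≡ x + (y + z)
    ·-mono         : ∀ {x x′ y y′} → x ≤ x′ → y ≤ y′ → x · y ≤ x′ · y′
    +-mono         : ∀ {x x′ y y′} → x ≤ x′ → y ≤ y′ → x + y ≤ x′ + y′
    hemidistribˡ   : ∀ x y z → x · (y + z) ≤ (x · y) + z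
    hemidistribʳ   : ∀ x y z → (z + y) · x ≤ z + (y · x)

module _ {c ℓ : Level} (B : Bisemigroup c ℓ) where
  open Bisemigroup B

  IsLeftComplement : Carrier → Carrier → Set (c ⊔ ℓ)
  IsLeftComplement y x =
    ∀ w → (w + (y · x) ≤ w) × ((y · x) + w ≤ w)
        × (w ≤ w · (x + y)) × (w ≤ (x + y) · w)
    where open import Data.Product using (_×_)

  IsRightComplement : Carrier → Carrier → Set (c ⊔ ℓ)
  IsRightComplement y x =
    ∀ w → (w + (x · y) ≤ w) × ((x · y) + w ≤ w)
        × (w ≤ w · (y + x)) × (w ≤ (y + x) · w)
    where open import Data.Product using (_×_)

{-# OPTIONS --safe #-}
module Submission where

open import Defs
open import Level using (Level; _⊔_)
open import Data.Product using (_×_; _,_)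
open import Relation.Binary.PropositionalEquality using (_≡_)
open import Relation.Binary.Bundles using (Poset)
open import Relation.Binary.Structures using (IsPartialOrder)
import Relation.Binary.Reasoning.PartialOrder as PosetReasoning

-- If y₁ and y₂ are left complements of x, then
--   y₁ ≤ y₁ · (x + y₂) ≤ (y₁ · x) + y₂ ≤ y₂,
-- since multiplying by x + y₂ can only increase and adding y₁ · x can only
-- decrease, and hemidistributivity links the two; by symmetry y₂ ≤ y₁.

module _ {c ℓ : Level} (B : Bisemigroup c ℓ) where
  open Bisemigroup B
  open IsPartialOrder isPartialOrder using (antisym)

  poset : Poset c c (c ⊔ ℓ)
  poset = record { isPartialOrder = isPartialOrder }

  open PosetReasoning poset

  leftComplement-≤ : ∀ {x y₁ y₂} →
    IsLeftComplement B y₁ x → IsLeftComplement B y₂ x → y₁ ≤ y₂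
  leftComplement-≤ {x} {y₁} {y₂} y₁-compl y₂-compl = begin
    y₁            ≤⟨ y₁≤y₁·[x+y₂] ⟩
    y₁ · (x + y₂) ≤⟨ hemidistribˡ y₁ x y₂ ⟩
    y₁ · x + y₂   ≤⟨ y₁·x+y₂≤y₂ ⟩
    y₂            ∎
    where
    y₁≤y₁·[x+y₂] : y₁ ≤ y₁ · (x + y₂)
    y₁≤y₁·[x+y₂] with y₂-compl y₁
    ... | _ , _ , le , _ = le
    y₁·x+y₂≤y₂ : y₁ · x + y₂ ≤ y₂
    y₁·x+y₂≤y₂ with y₁-compl y₂
    ... | _ , le , _ , _ = le

  rightComplement-≤ : ∀ {x y₁ y₂} →
    IsRightComplement B y₁ x → IsRightComplement B y₂ x → y₁ ≤ y₂
  rightComplement-≤ {x} {y₁} {y₂} y₁-compl y₂-compl = begin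
    y₁            ≤⟨ y₁≤[y₂+x]·y₁ ⟩
    (y₂ + x) · y₁ ≤⟨ hemidistribʳ y₁ x y₂ ⟩
    y₂ + x · y₁   ≤⟨ y₂+x·y₁≤y₂ ⟩
    y₂            ∎
    where
    y₁≤[y₂+x]·y₁ : y₁ ≤ (y₂ + x) · y₁
    y₁≤[y₂+x]·y₁ with y₂-compl y₁
    ... | _ , _ , _ , le = le
    y₂+x·y₁≤y₂ : y₂ + x · y₁ ≤ y₂
    y₂+x·y₁≤y₂ with y₁-compl y₂
    ... | le , _ , _ , _ = le

  leftComplement-unique : ∀ {x y₁ y₂} →
    IsLeftComplement B y₁ x → IsLeftComplement B y₂ x → y₁ ≡ y₂
  leftComplement-unique h₁ h₂ = antisym (leftComplement-≤ h₁ h₂) (leftComplement-≤ h₂ h₁)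

  rightComplement-unique : ∀ {x y₁ y₂} →
    IsRightComplement B y₁ x → IsRightComplement B y₂ x → y₁ ≡ y₂
  rightComplement-unique h₁ h₂ = antisym (rightComplement-≤ h₁ h₂) (rightComplement-≤ h₂ h₁)

mainTheorem3 : ∀ {c ℓ : Level} (B : Bisemigroup c ℓ) (x y₁ y₂ : Bisemigroup.Carrier B) →
    (IsLeftComplement B y₁ x → IsLeftComplement B y₂ x → y₁ ≡ y₂)
    × (IsRightComplement B y₁ x → IsRightComplement B y₂ x → y₁ ≡ y₂)
mainTheorem3 B x y₁ y₂ = leftComplement-unique B , rightComplement-unique B
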